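{- Consider any execution of the Happy Swap Algorithm on a token swapping instance whose graph $G$ is a tree. If a move $t\to v$ is inevitable, then the edge between the current vertex $v(t)$ of $t$ (just before the move) and $v$ is an edge of the path $p(t)$.
   Context: A token swapping instance consists of a tree $G=(V,E)$ with $n$ vertices, a set $T$ of $n$ tokens, and bijections $v_0,v_f:T\to V$ (starting and destination vertices); at all times each vertex holds one token, $v(t)$ denotes the current vertex of $t$, and initially $v(t)=v_0(t)$. A swap of adjacent tokens $t_1,t_2$ (i.e. $(v(t_1),v(t_2))\in E$) exchanges their vertices; it consists of the two moves $t_1\to v(t_2)$ and $t_2\to v(t_1)$. $d$ denotes graph distance, $p(t)$ the unique path from $v_0(t)$ to $v_f(t)$, and $d(t)=d(v_0(t),v_f(t))$. A token $t$ is happy if $v(t)=v_f(t)$. A swap of $(t_1,t_2)$ is a happy swap if $d(v_f(t_1),v(t_2))=d(v_f(t_1),v(t_1))-1$ and $d(v_f(t_2),v(t_1))=d(v_f(t_2),v(t_2))-1$. It is a shove if one of the tokens, say $t_1$, is happy and $d(v_f(t_2),v(t_1))=d(v_f(t_2),v(t_2))-1$. The Happy Swap Algorithm repeatedly, while some token is not happy, performs an arbitrary available happy swap or shove. A move $t\to v$ is inevitable if it is among the first $d(t)$ moves of token $t$ during the execution, and redundant otherwise. -}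

module Defs where

open import Data.Nat using (ℕ; zero; suc; _≤_; _<_)
open import Data.Fin using (Fin; _≟_)
open import Data.List using (List; []; _∷_; take; length)
open import Data.List.Relation.Unary.Unique.Propositional using (Unique)
open import Data.Product using (Σ; ∃; _×_; _,_)
open import Data.Sum using (_⊎_)
open import Relation.Nullary using (¬_; yes; no)
open import Relation.Binary.PropositionalEquality using (_≡_)
open import Data.Empty using (⊥)

record Graph (n : ℕ) : Set₁ where
  field
    Adj    : Fin n → Fin n → Set
    sym    : ∀ {u v} → Adj u v → Adj v u
    irrefl : ∀ {u} → ¬ Adj u u
open Graph public

module _ {n : ℕ} (G : Graph n) where

  data Walk : Fin n → Fin n → ℕ → Set where
    nil  : ∀ {u} → Walk u u zero
    cons : ∀ {u w v k} → Adj G u w → Walk w v k → Walk u v (suc k)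

  verts : ∀ {u v k} → Walk u v k → List (Fin n)
  verts {u} nil        = u ∷ []
  verts {u} (cons e p) = u ∷ verts p

  IsPath : ∀ {u v k} → Walk u v k → Set
  IsPath p = Unique (verts p)

  -- a cycle: closed walk of length ≥ 3 whose vertices (apart from the
  -- repeated start/end vertex) are pairwise distinct
  IsCycle : ∀ {u k} → Walk u u k → Set
  IsCycle nil        = ⊥
  IsCycle (cons {k = k} e p) = (2 ≤ k) × Unique (verts p)

  Connected : Set
  Connected = ∀ u v → ∃ λ k → Walk u v k

  Acyclic : Set
  Acyclic = ∀ {u k} (c : Walk u u k) → ¬ IsCycle c

  IsTree : Set
  IsTree = Connected × Acyclic

  Dist : Fin n → Fin n → ℕ → Set
  Dist u v k = Walk u v k × (∀ m → Walk u v m → k ≤ m)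

  data EdgeOn (a b : Fin n) : ∀ {u v k} → Walk u v k → Set where
    here  : ∀ {v k} (e : Adj G a b) (p : Walk b v k) → EdgeOn a b (cons e p)
    there : ∀ {u w v k} (e : Adj G u w) {p : Walk w v k} →
            EdgeOn a b p → EdgeOn a b (cons e p)

  EdgeOf : Fin n → Fin n → ∀ {u v k} → Walk u v k → Set
  EdgeOf a b p = EdgeOn a b p ⊎ EdgeOn b a p

-- Token swapping.  Tokens and vertices are both Fin n.
-- A configuration assigns to each token its current vertex.

Config : ℕ → Set
Config n = Fin n → Fin n

Swap : ℕ → Set
Swap n = Fin n × Fin n

applySwap : ∀ {n} → Config n → Swap n → Config n
applySwap c (t₁ , t₂) t with t ≟ t₁
... | yes _ = c t₂
... | no _ with t ≟ t₂
...   | yes _ = c t₁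
...   | no _  = c t

runSwaps : ∀ {n} → Config n → List (Swap n) → Config n
runSwaps c []       = c
runSwaps c (s ∷ ss) = runSwaps (applySwap c s) ss

movesOf : ∀ {n} → Fin n → List (Swap n) → ℕ
movesOf t [] = zero
movesOf t ((a , b) ∷ ss) with t ≟ a | t ≟ b
... | no _ | no _ = movesOf t ss
... | _    | _    = suc (movesOf t ss)

module _ {n : ℕ} (G : Graph n) (vf : Fin n → Fin n) where

  Closer : Fin n → Fin n → Fin n → Set
  Closer x u w = ∃ λ a → Dist G x w a × Dist G x u (suc a)

  HappySwap : Config n → Fin n → Fin n → Set
  HappySwap c t₁ t₂ = Closer (vf t₁) (c t₁) (c t₂) × Closer (vf t₂) (c t₂) (c t₁)

  Shove : Config n → Fin n → Fin n → Set
  Shove c t₁ t₂ = (c t₁ ≡ vf t₁ × Closer (vf t₂) (c t₂) (c t₁))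
                ⊎ (c t₂ ≡ vf t₂ × Closer (vf t₁) (c t₁) (c t₂))

  AllowedSwap : Config n → Swap n → Set
  AllowedSwap c (t₁ , t₂) =
    Adj G (c t₁) (c t₂) × (HappySwap c t₁ t₂ ⊎ Shove c t₁ t₂)

  AllHappy : Config n → Set
  AllHappy c = ∀ t → c t ≡ vf t

  Execution : Config n → List (Swap n) → Set
  Execution c []       = AllHappy c
  Execution c (s ∷ ss) = (¬ AllHappy c) × AllowedSwap c s × Execution (applySwap c s) ss

{-# OPTIONS --safe #-}
module Submission where

-- In an acyclic graph the only neighbour of x closer to z than x is the next vertex
-- of a path from x to z: any other neighbour w would close a cycle through x with
-- that path and a shortest walk from z to w.  An unhappy token only takes part in
-- happy swaps and in shoves of which it is not the happy token, so each of its moves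
-- goes to a neighbour closer to its destination.  Hence, as long as t has made fewer
-- than d(t) ≤ |P| moves, it sits on P with the rest of P ahead of it, and its next
-- move traverses the next edge of P.

open import Defs
open import Data.Nat using (ℕ; suc; _+_; _<_; _≤_; z≤n; s≤s; s<s⁻¹)
open import Data.Nat.Properties using (≤-trans; <-≤-trans; n≮n)
open import Data.Fin using (Fin; zero; suc; toℕ; _≟_)
open import Data.List using (List; []; _∷_; length; lookup; take)
open import Data.List.Membership.Propositional using (_∈_; _∉_)
open import Data.List.Relation.Binary.Subset.Propositional using (_⊆_)
open import Data.List.Relation.Binary.Subset.Propositional.Properties using (∷⁺ʳ; xs⊆x∷xs)
open import Data.List.Relation.Unary.Any using (here; there)
import Data.List.Relation.Unary.All as All
open import Data.List.Relation.Unary.All.Properties using (¬Any⇒All¬; All¬⇒¬Any)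
open import Data.List.Relation.Unary.AllPairs using ([]; _∷_; tail)
open import Data.Product using (_×_; _,_; ∃; ∃₂)
open import Data.Sum as Sum using (_⊎_; inj₁; inj₂)
open import Data.Empty using (⊥-elim)
open import Function using (_∘_; id)
open import Function.Definitions using (Bijective)
open import Relation.Binary.PropositionalEquality as ≡ using (_≡_; _≢_; refl; subst; trans)
open import Relation.Nullary using (yes; no)

module _ {n : ℕ} (G : Graph n) where

  open import Data.List.Membership.DecPropositional (_≟_ {n}) using (_∈?_)

  private
    variable
      a b c x y z w : Fin n
      i j k : ℕ

  _++ʷ_ : Walk G a b i → Walk G b c j → Walk G a c (i + j)
  nil      ++ʷ q = q
  cons e p ++ʷ q = cons e (p ++ʷ q)

  ∈-verts-++⁻ : (p : Walk G a b i) (q : Walk G b c j) →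
                x ∈ verts G (p ++ʷ q) → x ∈ verts G p ⊎ x ∈ verts G q
  ∈-verts-++⁻ nil        q x∈         = inj₂ x∈
  ∈-verts-++⁻ (cons e p) q (here x≡a) = inj₁ (here x≡a)
  ∈-verts-++⁻ (cons e p) q (there x∈) = Sum.map₁ there (∈-verts-++⁻ p q x∈)

  end∈verts : (p : Walk G a b i) → b ∈ verts G p
  end∈verts nil        = here refl
  end∈verts (cons e p) = there (end∈verts p)

  prefixTo : (p : Walk G a b i) → x ∈ verts G p → ∃ λ m → m ≤ i × Walk G a x m
  prefixTo nil        (here refl)  = 0 , z≤n , nil
  prefixTo (cons e p) (here refl)  = 0 , z≤n , nil
  prefixTo (cons e p) (there x∈p) with prefixTo p x∈p
  ... | m , m≤i , q = suc m , s≤s m≤i , cons e q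

  suffixFrom : (p : Walk G a b i) → x ∈ verts G p →
               ∃₂ λ m (q : Walk G x b m) → verts G q ⊆ verts G p × (IsPath G p → IsPath G q)
  suffixFrom nil        (here refl)  = _ , nil , id , id
  suffixFrom (cons e p) (here refl)  = _ , cons e p , id , id
  suffixFrom (cons e p) (there x∈p) with suffixFrom p x∈p
  ... | m , q , q⊆p , tail-path =
    m , q , there ∘ q⊆p , λ { (_ ∷ p-path) → tail-path p-path }

  toPath : (p : Walk G a b i) → ∃₂ λ m (q : Walk G a b m) → IsPath G q × verts G q ⊆ verts G p
  toPath nil = _ , nil , All.[] ∷ [] , id
  toPath {a} (cons e p) with toPath p
  ... | m , q , q-path , q⊆p with a ∈? verts G q
  ...   | yes a∈q = let m′ , q′ , q′⊆q , suffix-path = suffixFrom q a∈q in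
                    m′ , q′ , suffix-path q-path , xs⊆x∷xs _ _ ∘ q⊆p ∘ q′⊆q
  ...   | no  a∉q = suc m , cons e q , ¬Any⇒All¬ (verts G q) a∉q ∷ q-path , ∷⁺ʳ a q⊆p

  path-start≢end : (e : Adj G x y) (q : Walk G y z j) → IsPath G (cons e q) → x ≢ z
  path-start≢end e q (x∉q ∷ _) = All.lookup x∉q (end∈verts q)

  avoiding-walk⇒neighbours-≡ : Acyclic G → Adj G x y → Adj G x w →
                                (q : Walk G y w j) → x ∉ verts G q → y ≡ w
  avoiding-walk⇒neighbours-≡ acyclic xy xw q x∉q with toPath q
  ... | _ , nil      , _      , _   = refl
  ... | _ , cons e r , r-path , r⊆q =
    ⊥-elim (acyclic (cons (sym G xw) (cons xy (cons e r)))
                    (s≤s (s≤s z≤n) , ¬Any⇒All¬ _ (x∉q ∘ r⊆q) ∷ r-path))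

  -- The walk from y along q to z and then to w avoids x, since x is farther from z than w.
  closer-neighbour-is-next-on-path : Acyclic G → (e : Adj G x y) (q : Walk G y z j) →
                                     IsPath G (cons e q) → Adj G x w →
                                     Dist G z w k → Dist G z x (suc k) → y ≡ w
  closer-neighbour-is-next-on-path {x = x} acyclic xy q (x∉q ∷ _) xw (r , _) (_ , x-minimal) =
    avoiding-walk⇒neighbours-≡ acyclic xy xw (q ++ʷ r)
      (Sum.[ All¬⇒¬Any x∉q , x∉r ] ∘ ∈-verts-++⁻ q r)
    where
    x∉r : x ∉ verts G r
    x∉r x∈r with prefixTo r x∈r
    ... | m , m≤k , r′ = n≮n _ (≤-trans (x-minimal m r′) m≤k)

module _ {n : ℕ} where

  private
    variable
      t a b : Fin n
      c : Config n
      ss : List (Swap n)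

  movesOf-∷-∉ : t ≢ a → t ≢ b → movesOf t ((a , b) ∷ ss) ≡ movesOf t ss
  movesOf-∷-∉ {t} {a} {b} t≢a t≢b with t ≟ a | t ≟ b
  ... | no _    | no _    = refl
  ... | yes t≡a | _       = ⊥-elim (t≢a t≡a)
  ... | no _    | yes t≡b = ⊥-elim (t≢b t≡b)

  movesOf-∷-∈ : t ≡ a ⊎ t ≡ b → movesOf t ((a , b) ∷ ss) ≡ suc (movesOf t ss)
  movesOf-∷-∈ {t} {a} {b} t∈ab with t ≟ a | t ≟ b | t∈ab
  ... | yes _ | _     | _         = refl
  ... | no _  | yes _ | _         = refl
  ... | no t≢a | no _  | inj₁ t≡a = ⊥-elim (t≢a t≡a)
  ... | no _  | no t≢b | inj₂ t≡b = ⊥-elim (t≢b t≡b)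

  applySwap-∉ : t ≢ a → t ≢ b → applySwap c (a , b) t ≡ c t
  applySwap-∉ {t} {a} {b} t≢a t≢b with t ≟ a
  ... | yes t≡a = ⊥-elim (t≢a t≡a)
  ... | no _ with t ≟ b
  ...   | yes t≡b = ⊥-elim (t≢b t≡b)
  ...   | no _    = refl

  applySwap-≡ˡ : t ≡ a → applySwap c (a , b) t ≡ c b
  applySwap-≡ˡ {t} {a} t≡a with t ≟ a
  ... | yes _   = refl
  ... | no t≢a  = ⊥-elim (t≢a t≡a)

  applySwap-≡ʳ : t ≢ a → t ≡ b → applySwap c (a , b) t ≡ c a
  applySwap-≡ʳ {t} {a} {b} t≢a t≡b with t ≟ a
  ... | yes t≡a = ⊥-elim (t≢a t≡a)
  ... | no _ with t ≟ b
  ...   | yes _   = refl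
  ...   | no t≢b  = ⊥-elim (t≢b t≡b)

  Partner : Swap n → Fin n → Fin n → Set
  Partner s t u = s ≡ (t , u) ⊎ s ≡ (u , t)

  data SwapEffect (c : Config n) (t : Fin n) (s : Swap n) (ss : List (Swap n)) : Set where
    untouched : movesOf t (s ∷ ss) ≡ movesOf t ss → applySwap c s t ≡ c t → SwapEffect c t s ss
    moved     : ∀ {u} → Partner s t u → movesOf t (s ∷ ss) ≡ suc (movesOf t ss) →
                applySwap c s t ≡ c u → SwapEffect c t s ss

  swapEffect : (c : Config n) (t : Fin n) (s : Swap n) (ss : List (Swap n)) → SwapEffect c t s ss
  swapEffect c t (a , b) ss with t ≟ a | t ≟ b
  ... | yes refl | _        = moved (inj₁ refl) (movesOf-∷-∈ {b = b} {ss} (inj₁ refl))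
                                                  (applySwap-≡ˡ {t = t} {c = c} {b = b} refl)
  ... | no  t≢a  | yes refl = moved (inj₂ refl) (movesOf-∷-∈ {ss = ss} (inj₂ refl))
                                                  (applySwap-≡ʳ t≢a refl)
  ... | no  t≢a  | no  t≢b  = untouched (movesOf-∷-∉ {ss = ss} t≢a t≢b) (applySwap-∉ t≢a t≢b)

module _ {n : ℕ} (G : Graph n) (acyclic : Acyclic G) (vf : Fin n → Fin n) where

  private
    variable
      t u x y : Fin n
      c : Config n
      s : Swap n
      j : ℕ

  unhappy-partner-moves-closer : Partner s t u → AllowedSwap G vf c s → c t ≢ vf t →
                                 Adj G (c t) (c u) × Closer G vf (vf t) (c t) (c u)
  unhappy-partner-moves-closer (inj₁ refl) (adj , inj₁ (closer , _))        _       = adj , closer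
  unhappy-partner-moves-closer (inj₁ refl) (adj , inj₂ (inj₁ (happy , _)))  unhappy = ⊥-elim (unhappy happy)
  unhappy-partner-moves-closer (inj₁ refl) (adj , inj₂ (inj₂ (_ , closer))) _       = adj , closer
  unhappy-partner-moves-closer (inj₂ refl) (adj , inj₁ (_ , closer))        _       = sym G adj , closer
  unhappy-partner-moves-closer (inj₂ refl) (adj , inj₂ (inj₁ (_ , closer))) _       = sym G adj , closer
  unhappy-partner-moves-closer (inj₂ refl) (adj , inj₂ (inj₂ (happy , _)))  unhappy = ⊥-elim (unhappy happy)

  partner-is-next-on-path : Partner s t u → AllowedSwap G vf c s →
                            (e : Adj G (c t) y) (q : Walk G y (vf t) j) → IsPath G (cons e q) →
                            y ≡ c u
  partner-is-next-on-path partner allowed e q q-path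
    with unhappy-partner-moves-closer partner allowed (path-start≢end G e q q-path)
  ... | adj , _ , u-dist , t-dist =
    closer-neighbour-is-next-on-path G acyclic e q q-path adj u-dist t-dist

  execution-moves-along-path :
    (c : Config n) (ss : List (Swap n)) → Execution G vf c ss →
    (i : Fin (length ss)) → Partner (lookup ss i) t u →
    c t ≡ x → (q : Walk G x (vf t) j) → IsPath G q →
    movesOf t (take (toℕ i) ss) < j →
    EdgeOn G (runSwaps c (take (toℕ i) ss) t) (runSwaps c (take (toℕ i) ss) u) q
  execution-moves-along-path _ _ _ _ _ _ nil _ ()
  execution-moves-along-path c (s ∷ ss) (_ , allowed , _) zero partner refl (cons e q) q-path _
    with partner-is-next-on-path partner allowed e q q-path
  ... | refl = here e q
  execution-moves-along-path {t} c (s ∷ ss) (_ , allowed , exec) (suc i) partner refl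
                             (cons e q) q-path moves<j
    with swapEffect c t s (take (toℕ i) ss)
  ... | untouched moves≡ stays =
    execution-moves-along-path (applySwap c s) ss exec i partner stays (cons e q) q-path
      (subst (_< _) moves≡ moves<j)
  ... | moved s-partner moves≡ moved-to =
    there e (execution-moves-along-path (applySwap c s) ss exec i partner
               (trans moved-to (≡.sym (partner-is-next-on-path s-partner allowed e q q-path)))
               q (tail q-path) (s<s⁻¹ (subst (_< _) moves≡ moves<j)))

mainTheorem5 : ∀ {n} (G : Graph n) → IsTree G →
    (v₀ vf : Fin n → Fin n) → Bijective _≡_ _≡_ v₀ → Bijective _≡_ _≡_ vf →
    (ss : List (Swap n)) → Execution G vf v₀ ss →
    (i : Fin (length ss)) (t u : Fin n) →
    (lookup ss i ≡ (t , u) ⊎ lookup ss i ≡ (u , t)) →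
    (D : ℕ) → Dist G (v₀ t) (vf t) D →
    movesOf t (take (toℕ i) ss) < D →
    ∀ {k} (P : Walk G (v₀ t) (vf t) k) → IsPath G P →
    EdgeOf G (runSwaps v₀ (take (toℕ i) ss) t) (runSwaps v₀ (take (toℕ i) ss) u) P
mainTheorem5 G (_ , acyclic) v₀ vf _ _ ss exec i t u partner D (_ , D-minimal) moves<D P P-path =
  inj₁ (execution-moves-along-path G acyclic vf v₀ ss exec i partner refl P P-path
          (<-≤-trans moves<D (D-minimal _ P)))
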